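{- (i) For all $A\in\mathbb Q\langle V\rangle$ and all words $w\in V^*$, $A\circledast_a w\in\mathrm{Fil}_{\mathrm{ind}_{\max}(w)}\mathbb Q\langle V\rangle$. (ii) For every word $w\in V^*$, writing $\Delta_a(w)=\sum w_{(1)}\otimes w_{(2)}$, we have $\Delta_a(w)\in\mathbb Q\langle V\rangle\otimes\mathrm{Fil}^{\mathrm{ind}_{\max}(w)}\mathbb Q\langle V\rangle$, i.e. all right tensor factors $w_{(2)}$ lie in $\mathrm{Fil}^{\mathrm{ind}_{\max}(w)}\mathbb Q\langle V\rangle$.
   Context: $V=\{v_0,v_1,\dots\}$ with weight $\mathrm{wt}(v_0)=1$, $\mathrm{wt}(v_i)=i$. For a word $w=v_{k_1}\cdots v_{k_d}$ set $\mathrm{ind}_{\max}(w)=\max_s k_s$ (with the convention $0$ for the empty word); $\mathrm{Fil}^n\mathbb Q\langle V\rangle$ is the span of words with $\mathrm{ind}_{\max}\le n$ and $\mathrm{Fil}_n\mathbb Q\langle V\rangle$ the span of words with $\mathrm{ind}_{\max}\ge n$. Ari multiplicity $\mathrm m_{\mathbf k,\mathbf l}=(-1)^{|\mathbf k|+|\mathbf l|}\prod_i\binom{k_i-1}{l_i-1}$ with $\binom{ -1}{ -1}=1$, $\binom{k-1}{ -1}=\binom{ -1}{l-1}=0$ for $k,l>0$, usual binomials otherwise. $\mathbb Q\langle V\rangle=U(\mathrm{Lie}(V))$ with shuffle coproduct (letters primitive, Sweedler notation). $\triangleright_a$ is the post-Lie product on $\mathrm{Lie}(V)$ obtained from the free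 magma $M(V)$ (product $\star$): for a bracketing $t(\mathbf k)$ of $v_{k_1},\dots,v_{k_r}$, $t(\mathbf k)\triangleright_av_0=0$ and $t(\mathbf k)\triangleright_av_s=\sum_{\mathbf l}\mathrm m_{\mathbf k,\mathbf l}v_{s+|\mathbf k|-|\mathbf l|}\star t(\mathbf l)$ ($s\ge1$), extended linearly in $t$, as a derivation in the second argument, and descended via $a\star b\mapsto[a,b]$; extended to $\mathbb Q\langle V\rangle^{\otimes2}$ by $x\triangleright\mathbf1=0$, $\mathbf1\triangleright A=A$, $xA\triangleright y=x\triangleright(A\triangleright y)-(x\triangleright A)\triangleright y$, $A\triangleright BC=(A_{(1)}\triangleright B)(A_{(2)}\triangleright C)$. $A\circledast_aB=A_{(1)}(A_{(2)}\triangleright_aB)$, and $\Delta_a$ is dual to $\circledast_a$ for the pairing making words orthonormal. -}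

module Defs where

open import Data.Nat as ℕ using (ℕ; zero; suc; _⊔_; _<_)
open import Data.Integer as ℤ using (ℤ)
open import Data.Rational as ℚ using (ℚ; 0ℚ; 1ℚ)
open import Data.List using (List; []; _∷_; _++_; map; concat; concatMap; foldr; length)
open import Data.List.Properties using (≡-dec)
open import Data.Vec as Vec using (Vec; []; _∷_)
open import Data.Product using (_×_; _,_; proj₁; proj₂)
open import Relation.Binary.PropositionalEquality using (_≡_)
open import Relation.Nullary using (yes; no)

-- Letters v_i are encoded by i : ℕ; words are lists of letters.

Word : Set
Word = List ℕ

indmax : Word → ℕ
indmax = foldr _⊔_ 0

-- Elements of ℚ⟨V⟩: finite formal ℚ-linear combinations of words
-- (repetitions allowed; the element is the sum).
Poly : Set
Poly = List (ℚ × Word)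

coeff : Word → Poly → ℚ
coeff u [] = 0ℚ
coeff u ((c , w) ∷ p) with ≡-dec ℕ._≟_ w u
... | yes _ = c ℚ.+ coeff u p
... | no  _ = coeff u p

-- Fil_n : span of words with ind_max ≥ n
InFilLower : ℕ → Poly → Set
InFilLower n p = ∀ u → indmax u < n → coeff u p ≡ 0ℚ

scale : ℚ → Poly → Poly
scale c = map (λ { (d , w) → (c ℚ.* d , w) })

neg : Poly → Poly
neg = scale (ℚ.- 1ℚ)

mulP : Poly → Poly → Poly
mulP p q = concatMap (λ { (c , u) → map (λ { (d , v) → (c ℚ.* d , u ++ v) }) q }) p

data Tree : Set where
  leaf : ℕ → Tree
  node : Tree → Tree → Tree

-- descent a ⋆ b ↦ [a,b] = ab - ba into ℚ⟨V⟩ = U(Lie V)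
evalTree : Tree → Poly
evalTree (leaf s) = (1ℚ , s ∷ []) ∷ []
evalTree (node a b) = mulP (evalTree a) (evalTree b) ++ neg (mulP (evalTree b) (evalTree a))

-- a product (in U(Lie V)) of Lie elements given as magma elements
TWord : Set
TWord = List Tree

evalTWord : TWord → Poly
evalTWord [] = (1ℚ , []) ∷ []
evalTWord (t ∷ ts) = mulP (evalTree t) (evalTWord ts)

TPoly : Set
TPoly = List (ℚ × TWord)

evalTPoly : TPoly → Poly
evalTPoly [] = []
evalTPoly ((c , ts) ∷ p) = scale c (evalTWord ts) ++ evalTPoly p

scaleT : ℚ → TPoly → TPoly
scaleT c = map (λ { (d , w) → (c ℚ.* d , w) })

binom : ℕ → ℕ → ℕ
binom n zero = 1
binom zero (suc k) = 0
binom (suc n) (suc k) = binom n k ℕ.+ binom n (suc k)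

-- binom' k l = binomial (k-1 choose l-1) with the stated conventions
binom' : ℕ → ℕ → ℕ
binom' zero zero = 1
binom' zero (suc l) = 0
binom' (suc k) zero = 0
binom' (suc k) (suc l) = binom k l

sumℕ : List ℕ → ℕ
sumℕ = foldr ℕ._+_ 0

sign : ℕ → ℚ
sign zero = 1ℚ
sign (suc n) = ℚ.- sign n

fromℕ : ℕ → ℚ
fromℕ n = ℤ.+ n ℚ./ 1

prodBinom : List ℕ → List ℕ → ℕ
prodBinom (k ∷ ks) (l ∷ ls) = binom' k l ℕ.* prodBinom ks ls
prodBinom _ _ = 1

mult : List ℕ → List ℕ → ℚ
mult ks ls = sign (sumℕ ks ℕ.+ sumℕ ls) ℚ.* fromℕ (prodBinom ks ls)

upToIncl : ℕ → List ℕ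
upToIncl zero = 0 ∷ []
upToIncl (suc k) = upToIncl k ++ (suc k ∷ [])

-- all tuples l with 0 ≤ l_i ≤ k_i (all other tuples have m_{k,l} = 0)
tuples : List ℕ → List (List ℕ)
tuples [] = [] ∷ []
tuples (k ∷ ks) = concatMap (λ l → map (l ∷_) (tuples ks)) (upToIncl k)

leaves : Tree → List ℕ
leaves (leaf k) = k ∷ []
leaves (node a b) = leaves a ++ leaves b

fill : Tree → List ℕ → Tree × List ℕ
fill (leaf k) [] = leaf k , []
fill (leaf k) (l ∷ ls) = leaf l , ls
fill (node a b) ls with fill a ls
... | a' , ls' with fill b ls'
... | b' , ls'' = node a' b' , ls''

TreePoly : Set
TreePoly = List (ℚ × Tree)

actLeaf : Tree → ℕ → TreePoly
actLeaf t zero = []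
actLeaf t (suc s) =
  map (λ ls → mult ks ls , node (leaf (suc s ℕ.+ sumℕ ks ℕ.∸ sumℕ ls)) (proj₁ (fill t ls)))
      (tuples ks)
  where ks = leaves t

actTree : Tree → Tree → TreePoly
actTree t (leaf s) = actLeaf t s
actTree t (node a b) =
  map (λ { (c , x) → c , node x b }) (actTree t a) ++
  map (λ { (c , y) → c , node a y }) (actTree t b)

-- t ▷ (u_1 ⋯ u_n) in U(Lie V): t primitive, acts as a derivation; t ▷ 1 = 0
actTWord : Tree → TWord → TPoly
actTWord t [] = []
actTWord t (u ∷ us) =
  map (λ { (c , x) → c , x ∷ us }) (actTree t u) ++
  map (λ { (c , ws) → c , u ∷ ws }) (actTWord t us)

actTPoly : Tree → TPoly → TPoly
actTPoly t [] = []
actTPoly t ((c , w) ∷ p) = scaleT c (actTWord t w) ++ actTPoly t p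

-- same, for left factors of fixed length n (t ▷ preserves length)
actTVec : (n : ℕ) → Tree → Vec Tree n → List (ℚ × Vec Tree n)
actTVec zero t [] = []
actTVec (suc n) t (u ∷ us) =
  map (λ { (c , x) → c , x ∷ us }) (actTree t u) ++
  map (λ { (c , ws) → c , u ∷ ws }) (actTVec n t us)

actVec : (n : ℕ) → Vec Tree n → TPoly → TPoly
actLin : (n : ℕ) → List (ℚ × Vec Tree n) → TPoly → TPoly
actVec zero [] B = B
actVec (suc n) (x ∷ A) B =
  actTPoly x (actVec n A B) ++ scaleT (ℚ.- 1ℚ) (actLin n (actTVec n x A) B)
actLin n [] B = []
actLin n ((c , A) ∷ p) B = scaleT c (actVec n A B) ++ actLin n p B

actWord : Word → TPoly → TPoly
actWord w B = actVec (length w) (Vec.map leaf (Vec.fromList w)) B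

-- Shuffle (deshuffle) coproduct of a word: Σ_S w|_S ⊗ w|_{S^c}

deshuffle : Word → List (Word × Word)
deshuffle [] = ([] , []) ∷ []
deshuffle (x ∷ w) = concatMap (λ { (u , v) → (x ∷ u , v) ∷ (u , x ∷ v) ∷ [] }) (deshuffle w)

-- A ⊛_a B = A_(1) (A_(2) ▷_a B)
⊛word : Word → Poly → Poly
⊛word a B =
  concatMap (λ { (a1 , a2) → mulP ((1ℚ , a1) ∷ [])
                   (evalTPoly (actWord a2 (map (λ { (c , w) → c , map leaf w }) B))) })
            (deshuffle a)

_⊛a_ : Poly → Poly → Poly
A ⊛a B = concatMap (λ { (c , a) → scale c (⊛word a B) }) A

-- Δ_a dual to ⊛_a :  ⟨Δ_a(w), u ⊗ v⟩ = ⟨u ⊛_a v, w⟩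
ΔaCoeff : Word → Word → Word → ℚ
ΔaCoeff w u v = coeff w (((1ℚ , u) ∷ []) ⊛a ((1ℚ , v) ∷ []))

-- Δ_a(w) ∈ ℚ⟨V⟩ ⊗ Fil^n ℚ⟨V⟩ : every u ⊗ v with ind_max v > n has coefficient 0
ΔaInRightFil : ℕ → Word → Set
ΔaInRightFil n w = ∀ u v → n < indmax v → ΔaCoeff w u v ≡ 0ℚ

module Submission where

open import Defs
open import Data.List using (List; []; _∷_)
open import Data.Product using (_×_; _,_)
open import Data.Rational using (ℚ; 1ℚ)

open import Data.Empty using (⊥-elim)
open import Data.List using (map; concatMap; _++_; length)
open import Data.List.Properties using (≡-dec)
open import Data.List.Relation.Unary.All as All using (All; []; _∷_)
open import Data.List.Relation.Unary.All.Properties using (++⁺; concat⁺; map⁺; gmap⁺)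
open import Data.Nat as ℕ using (ℕ; zero; suc; _⊔_; _+_; _∸_; _<_; _≤_; z≤n)
open import Data.Nat.Properties
open import Data.Product using (proj₂)
open import Data.Rational using (0ℚ; -_)
import Data.Vec as Vec
open import Relation.Binary.PropositionalEquality using (_≡_; refl; sym; trans; cong; subst)
open import Relation.Nullary using (yes; no)

-- No operation entering ⊛_a lowers ind_max: concatenation takes the maximum,
-- v_0 is annihilated, and t(k) ▷ v_s (s ≥ 1) only replaces v_s by the letter
-- v_{s+|k|-|l|} with |l| ≤ |k|. Hence every word occurring in A ⊛_a w, computed
-- in the magma before expanding brackets, has ind_max ≥ ind_max w, which is (i);
-- (ii) is (i) read through the duality defining Δ_a.

treeIndmax : Tree → ℕ
treeIndmax (leaf k)   = k
treeIndmax (node a b) = treeIndmax a ⊔ treeIndmax b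

twordIndmax : TWord → ℕ
twordIndmax []       = 0
twordIndmax (t ∷ ts) = treeIndmax t ⊔ twordIndmax ts

-- A condition on the formal sum as written (every term has degree ≥ n); it
-- gives InFilLower without any analysis of cancellations.
Support≥ : {X : Set} → (X → ℕ) → ℕ → List (ℚ × X) → Set
Support≥ deg n = All (λ e → n ≤ deg (proj₂ e))

concatMap⁺ : {A B : Set} {Q : B → Set} {f : A → List B} (xs : List A) →
             (∀ x → All Q (f x)) → All Q (concatMap f xs)
concatMap⁺ xs g = concat⁺ (map⁺ (All.universal g xs))

Support≥-weaken : {X : Set} {deg : X → ℕ} {m n : ℕ} {p : List (ℚ × X)} →
                  m ≤ n → Support≥ deg n p → Support≥ deg m p
Support≥-weaken m≤n = All.map (≤-trans m≤n)

Support≥-scale : ∀ {n p} c → Support≥ indmax n p → Support≥ indmax n (scale c p)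
Support≥-scale c = gmap⁺ (λ h → h)

Support≥-scaleT : ∀ {n p} c → Support≥ twordIndmax n p → Support≥ twordIndmax n (scaleT c p)
Support≥-scaleT c = gmap⁺ (λ h → h)

indmax-++ : ∀ u v → indmax (u ++ v) ≡ indmax u ⊔ indmax v
indmax-++ []      v = refl
indmax-++ (x ∷ u) v = trans (cong (x ⊔_) (indmax-++ u v)) (sym (⊔-assoc x (indmax u) (indmax v)))

Support≥-mulP : ∀ {m n p q} → Support≥ indmax m p → Support≥ indmax n q →
                Support≥ indmax (m ⊔ n) (mulP p q)
Support≥-mulP hp hq = concat⁺ (gmap⁺ (λ { {_ , u} m≤u →
  gmap⁺ (λ { {_ , v} n≤v → subst (_ ≤_) (sym (indmax-++ u v)) (⊔-mono-≤ m≤u n≤v) }) hq }) hp)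

Support≥-evalTree : ∀ t → Support≥ indmax (treeIndmax t) (evalTree t)
Support≥-evalTree (leaf s)   = m≤m⊔n s 0 ∷ []
Support≥-evalTree (node a b) =
  ++⁺ (Support≥-mulP (Support≥-evalTree a) (Support≥-evalTree b))
      (Support≥-scale (- 1ℚ)
        (subst (λ n → Support≥ indmax n (mulP (evalTree b) (evalTree a)))
               (⊔-comm (treeIndmax b) (treeIndmax a))
               (Support≥-mulP (Support≥-evalTree b) (Support≥-evalTree a))))

Support≥-evalTWord : ∀ ts → Support≥ indmax (twordIndmax ts) (evalTWord ts)
Support≥-evalTWord []       = z≤n ∷ []
Support≥-evalTWord (t ∷ ts) = Support≥-mulP (Support≥-evalTree t) (Support≥-evalTWord ts)

Support≥-evalTPoly : ∀ {n} p → Support≥ twordIndmax n p → Support≥ indmax n (evalTPoly p)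
Support≥-evalTPoly []              []       = []
Support≥-evalTPoly ((c , ts) ∷ p) (h ∷ hs) =
  ++⁺ (Support≥-scale c (Support≥-weaken h (Support≥-evalTWord ts))) (Support≥-evalTPoly p hs)

upToIncl-≤ : ∀ k → All (_≤ k) (upToIncl k)
upToIncl-≤ zero    = z≤n ∷ []
upToIncl-≤ (suc k) = ++⁺ (All.map m≤n⇒m≤1+n (upToIncl-≤ k)) (≤-refl ∷ [])

tuples-sum≤ : ∀ ks → All (λ ls → sumℕ ls ≤ sumℕ ks) (tuples ks)
tuples-sum≤ []       = z≤n ∷ []
tuples-sum≤ (k ∷ ks) = concat⁺ (gmap⁺ (λ l≤k → gmap⁺ (+-mono-≤ l≤k) (tuples-sum≤ ks)) (upToIncl-≤ k))

m≤m+n∸o : ∀ m {n o} → o ≤ n → m ≤ m + n ∸ o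
m≤m+n∸o m {n} {o} o≤n = subst (m ≤_) (sym (+-∸-assoc m o≤n)) (m≤m+n m (n ∸ o))

Support≥-actLeaf : ∀ t s → Support≥ treeIndmax s (actLeaf t s)
Support≥-actLeaf t zero    = []
Support≥-actLeaf t (suc s) =
  gmap⁺ (λ |l|≤|k| → ≤-trans (m≤m+n∸o (suc s) |l|≤|k|) (m≤m⊔n _ _)) (tuples-sum≤ (leaves t))

Support≥-actTree : ∀ t u → Support≥ treeIndmax (treeIndmax u) (actTree t u)
Support≥-actTree t (leaf s)   = Support≥-actLeaf t s
Support≥-actTree t (node a b) =
  ++⁺ (gmap⁺ (⊔-monoˡ-≤ (treeIndmax b)) (Support≥-actTree t a))
      (gmap⁺ (⊔-monoʳ-≤ (treeIndmax a)) (Support≥-actTree t b))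

Support≥-actTWord : ∀ t us → Support≥ twordIndmax (twordIndmax us) (actTWord t us)
Support≥-actTWord t []       = []
Support≥-actTWord t (u ∷ us) =
  ++⁺ (gmap⁺ (⊔-monoˡ-≤ (twordIndmax us)) (Support≥-actTree t u))
      (gmap⁺ (⊔-monoʳ-≤ (treeIndmax u)) (Support≥-actTWord t us))

Support≥-actTPoly : ∀ {n} t B → Support≥ twordIndmax n B → Support≥ twordIndmax n (actTPoly t B)
Support≥-actTPoly t []            []       = []
Support≥-actTPoly t ((c , w) ∷ B) (h ∷ hs) =
  ++⁺ (Support≥-scaleT c (Support≥-weaken h (Support≥-actTWord t w))) (Support≥-actTPoly t B hs)

Support≥-actVec : ∀ {m} n A B → Support≥ twordIndmax m B → Support≥ twordIndmax m (actVec n A B)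
Support≥-actLin : ∀ {m} n p B → Support≥ twordIndmax m B → Support≥ twordIndmax m (actLin n p B)
Support≥-actVec zero    Vec.[]         B h = h
Support≥-actVec (suc n) (x Vec.∷ A) B h =
  ++⁺ (Support≥-actTPoly x (actVec n A B) (Support≥-actVec n A B h))
      (Support≥-scaleT (- 1ℚ) (Support≥-actLin n (actTVec n x A) B h))
Support≥-actLin n []            B h = []
Support≥-actLin n ((c , A) ∷ p) B h =
  ++⁺ (Support≥-scaleT c (Support≥-actVec n A B h)) (Support≥-actLin n p B h)

twordIndmax-map-leaf : ∀ w → twordIndmax (map leaf w) ≡ indmax w
twordIndmax-map-leaf []      = refl
twordIndmax-map-leaf (x ∷ w) = cong (x ⊔_) (twordIndmax-map-leaf w)

Support≥-⊛word : ∀ a w → Support≥ indmax (indmax w) (⊛word a ((1ℚ , w) ∷ []))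
Support≥-⊛word a w = concatMap⁺ (deshuffle a) λ { (a₁ , a₂) →
  Support≥-mulP {p = (1ℚ , a₁) ∷ []} (z≤n ∷ [])
    (Support≥-evalTPoly _ (Support≥-actVec (length a₂) (Vec.map leaf (Vec.fromList a₂)) _
      (≤-reflexive (sym (twordIndmax-map-leaf w)) ∷ []))) }

Support≥-⊛a : ∀ A w → Support≥ indmax (indmax w) (A ⊛a ((1ℚ , w) ∷ []))
Support≥-⊛a A w = concatMap⁺ A λ { (c , a) → Support≥-scale c (Support≥-⊛word a w) }

coeff-below-support : ∀ {n} u p → Support≥ indmax n p → indmax u < n → coeff u p ≡ 0ℚ
coeff-below-support u []            []       u<n = refl
coeff-below-support u ((c , w) ∷ p) (h ∷ hs) u<n with ≡-dec ℕ._≟_ w u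
... | yes refl = ⊥-elim (<-irrefl refl (≤-<-trans h u<n))
... | no  _    = coeff-below-support u p hs u<n

proposition4p27 : ((A : Poly) (w : Word) → InFilLower (indmax w) (A ⊛a ((1ℚ , w) ∷ [])))
                  × ((w : Word) → ΔaInRightFil (indmax w) w)
proposition4p27 =
  (λ A w u u<w → coeff-below-support u _ (Support≥-⊛a A w) u<w) ,
  (λ w u v w<v → coeff-below-support w _ (Support≥-⊛a ((1ℚ , u) ∷ []) v) w<v)
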